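{- Let $p$ be a prime and let $a,b,k\in\mathbb{Z}$ with $a>0$, $b\neq 0$, and $k\le \operatorname{ord}_p(b)-\operatorname{ord}_p(a)$. Let $q_p$ be the unique $q\in\mathbb{Z}[\tfrac1p]$ for which there is $r\in\mathbb{Z}[\tfrac1p]$ with $b=aq-r$, $0\le r<ap^k$ and $|r|_p\le|ap^k|_p$. Let $q_\infty$ be the unique integer for which $b=ap^kq_\infty-r'$ with $0\le r'<ap^k$. Then $q_p=q_\infty p^k$.
   Context: $\operatorname{ord}_p$ is the $p$-adic valuation and $|\cdot|_p$ the $p$-adic absolute value ($|x|_p=p^{ -\operatorname{ord}_p(x)}$, $|0|_p=0$). The quotient $q_p$ is the quotient of the "$p^k$-division algorithm" of $b$ by $a$; $q_\infty$ is the quotient of the (modified) classical division algorithm of $b$ by $ap^k$. -}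

module Defs where

open import Data.Nat as ℕ using (ℕ; zero; suc)
open import Data.Nat.DivMod using (_%_; _/_)
open import Data.Nat.Properties using (m^n≢0)
open import Data.Integer as ℤ using (ℤ; +_; -[1+_])
open import Data.Rational as ℚ using (ℚ)
open import Data.Product using (∃)
open import Relation.Binary.PropositionalEquality using (_≡_)

-- p-adic valuation of a natural number n (for p ≥ 2 and n > 0),
-- computed by repeated division, with fuel (the fuel n always suffices).
-- Convention: the value at n = 0 is 0 (never used for n = 0 below).
ordAux : ℕ → ℕ → ℕ → ℕ
ordAux zero p n = 0
ordAux (suc f) zero n = 0
ordAux (suc f) (suc p') zero = 0
ordAux (suc f) (suc p') (suc m) with suc m % suc p'
... | zero = suc (ordAux f (suc p') (suc m / suc p'))
... | suc _ = 0

ordℕ : ℕ → ℕ → ℕ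
ordℕ p n = ordAux n p n

ordℤ : ℕ → ℤ → ℤ
ordℤ p z = + ordℕ p ℤ.∣ z ∣

ordℚ : ℕ → ℚ → ℤ
ordℚ p x = ordℤ p (ℚ.numerator x) ℤ.- (+ ordℕ p (ℚ.denominatorℕ x))

_^ℕ_ : ℚ → ℕ → ℚ
x ^ℕ zero = ℚ.1ℚ
x ^ℕ suc n = x ℚ.* (x ^ℕ n)

-- p^k for an integer exponent k (p a natural number; for p = 0 the
-- negative powers are set to 0, irrelevant since p is prime below)
pow : ℕ → ℤ → ℚ
pow p (+ n) = (+ p ℚ./ 1) ^ℕ n
pow zero -[1+ n ] = ℚ.0ℚ
pow (suc p') -[1+ n ] = (+ 1) ℚ./ (suc p' ℕ.^ suc n)
  where instance _ = m^n≢0 (suc p') (suc n)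

absP : ℕ → ℚ → ℚ
absP p x with ℚ.numerator x
... | + zero = ℚ.0ℚ
... | _ = pow p (ℤ.- ordℚ p x)

InZ[1/p] : ℕ → ℚ → Set
InZ[1/p] p x = ∃ λ (n : ℕ) → ℚ.denominatorℕ (x ℚ.* ((+ p ℚ./ 1) ^ℕ n)) ≡ 1

ι : ℤ → ℚ
ι z = z ℚ./ 1

-- Idea.  Multiply everything by one large power p^N.  Since q_p and r lie in
-- ℤ[1/p], Q = q_p·p^N and R = r·p^N are integers, and with e = k + N ≥ 0 the
-- division identity b = a·q_p − r becomes the integer identity
--     b·p^N = a·Q − R.
-- The hypothesis |r|_p ≤ |a p^k|_p says p^(ord a + e) ∣ R, and the hypothesis
-- k ≤ ord b − ord a says p^(ord a + e) ∣ b·p^N; hence p^(ord a + e) ∣ a·Q, and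
-- cancelling the p-part of a gives p^e ∣ Q, i.e. q_p = m·p^k for an integer m.
-- Now b = (a p^k)·m − r is a classical division with remainder 0 ≤ r < a p^k,
-- so uniqueness of the classical quotient gives m = q_∞.
module Submission where

open import Defs
open import Data.Nat using (ℕ)
open import Data.Nat.Primality using (Prime)
open import Data.Integer as ℤ using (ℤ)
open import Data.Rational as ℚ using (ℚ)
open import Relation.Binary.PropositionalEquality using (_≡_; _≢_)

open import Data.Nat as ℕ using (zero; suc; NonZero)
import Data.Nat.Properties as ℕP
import Data.Nat.Divisibility as ℕD
open import Data.Nat.DivMod using (m*n/n≡m)
open import Data.Nat.Primality using (¬prime[0]; ¬prime[1]; euclidsLemma; prime⇒nonZero)
import Data.Nat.Coprimality as Coprimality
open import Data.Integer using (+_; -[1+_]; +[1+_])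
import Data.Integer.Properties as ℤP
import Data.Integer.Divisibility.Signed as ℤD
open import Data.Rational using (mkℚ)
import Data.Rational.Properties as ℚP
import Data.Rational.Unnormalised as ℚᵘ
import Data.Rational.Unnormalised.Properties as ℚᵘP
open import Data.Product using (∃; _,_; proj₁; proj₂)
open import Data.Sum using (inj₁; inj₂; [_,_]′)
open import Data.Empty using (⊥-elim)
open import Relation.Nullary using (¬_; yes; no)
open import Relation.Binary.PropositionalEquality
  using (refl; sym; trans; cong; cong₂; subst; subst₂; ≢-sym; module ≡-Reasoning)
import Data.Nat.Solver
import Data.Integer.Solver
import Data.Rational.Solver
module ℕSolver = Data.Nat.Solver.+-*-Solver
module ℤSolver = Data.Integer.Solver.+-*-Solver
module ℚSolver = Data.Rational.Solver.+-*-Solver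

ιⁿ : ℤ → ℚ
ιⁿ z = mkℚ z 0 (Coprimality.sym (Coprimality.1-coprimeTo _))

ι-mk : ∀ z → ι z ≡ ιⁿ z
ι-mk z = ℚP.↥p/↧p≡p (ιⁿ z)

ι-* : ∀ x y → ι (x ℤ.* y) ≡ ι x ℚ.* ι y
ι-* x y = sym (cong₂ ℚ._*_ (ι-mk x) (ι-mk y))

ι-+ : ∀ x y → ι (x ℤ.+ y) ≡ ι x ℚ.+ ι y
ι-+ x y = sym (trans (cong₂ ℚ._+_ (ι-mk x) (ι-mk y))
  (cong (λ w → w ℚ./ 1) (cong₂ ℤ._+_ (ℤP.*-identityʳ x) (ℤP.*-identityʳ y))))

ι-neg : ∀ x → ι (ℤ.- x) ≡ ℚ.- ι x
ι-neg x = trans (ι-mk (ℤ.- x)) (trans (neg-mk x) (cong ℚ.-_ (sym (ι-mk x))))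
  where
  neg-mk : ∀ x → ιⁿ (ℤ.- x) ≡ ℚ.- ιⁿ x
  neg-mk (+ zero) = refl
  neg-mk +[1+ n ] = refl
  neg-mk -[1+ n ] = refl

ι-- : ∀ x y → ι (x ℤ.- y) ≡ ι x ℚ.- ι y
ι-- x y = trans (ι-+ x (ℤ.- y)) (cong (ι x ℚ.+_) (ι-neg y))

ι-≤ : ∀ {x y} → x ℤ.≤ y → ι x ℚ.≤ ι y
ι-≤ {x} {y} h rewrite ι-mk x | ι-mk y =
  ℚ.*≤* (subst₂ ℤ._≤_ (sym (ℤP.*-identityʳ x)) (sym (ℤP.*-identityʳ y)) h)

ι-≤⁻ : ∀ {x y} → ι x ℚ.≤ ι y → x ℤ.≤ y
ι-≤⁻ {x} {y} h rewrite ι-mk x | ι-mk y with h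
... | ℚ.*≤* h′ = subst₂ ℤ._≤_ (ℤP.*-identityʳ x) (ℤP.*-identityʳ y) h′

ι-< : ∀ {x y} → x ℤ.< y → ι x ℚ.< ι y
ι-< {x} {y} h rewrite ι-mk x | ι-mk y =
  ℚ.*<* (subst₂ ℤ._<_ (sym (ℤP.*-identityʳ x)) (sym (ℤP.*-identityʳ y)) h)

ι-injective : ∀ {x y} → ι x ≡ ι y → x ≡ y
ι-injective e = ℤP.≤-antisym (ι-≤⁻ (ℚP.≤-reflexive e)) (ι-≤⁻ (ℚP.≤-reflexive (sym e)))

denominator1⇒ι : ∀ x → ℚ.denominatorℕ x ≡ 1 → x ≡ ι (ℚ.numerator x)
denominator1⇒ι (mkℚ X zero c) refl = sym (ι-mk X)

cross-multiply : ∀ X D .(c : Coprimality.Coprime ℤ.∣ X ∣ (suc D)) d n → mkℚ X D c ℚ.* ι (+ d) ≡ ι n →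
  X ℤ.* + d ℤ.* + 1 ≡ n ℤ.* + (suc D ℕ.* 1)
cross-multiply X D c d n e rewrite ι-mk (+ d) | ι-mk n
  with ℚᵘP.≃-trans (ℚᵘP.≃-sym (ℚP.toℚᵘ-homo-* (mkℚ X D c) (ιⁿ (+ d)))) (ℚP.toℚᵘ-cong e)
... | ℚᵘ.*≡* h = h

numerator≢0 : ∀ x c n → x ℚ.* c ≡ ι n → n ≢ ℤ.0ℤ → ℚ.numerator x ≢ ℤ.0ℤ
numerator≢0 x c n h n≢0 x≡0 =
  n≢0 (ι-injective (trans (sym h) (trans (cong (ℚ._* c) (ℚP.↥p≡0⇒p≡0 x x≡0)) (ℚP.*-zeroˡ c))))

*-cancelʳ-pos : ∀ c .{{_ : ℚ.Positive c}} x y → x ℚ.* c ≡ y ℚ.* c → x ≡ y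
*-cancelʳ-pos c x y e =
  ℚP.≤-antisym (ℚP.*-cancelʳ-≤-pos c (ℚP.≤-reflexive e)) (ℚP.*-cancelʳ-≤-pos c (ℚP.≤-reflexive (sym e)))

1/d*d≡1 : ∀ d .{{_ : NonZero d}} → (+ 1 ℚ./ d) ℚ.* ι (+ d) ≡ ℚ.1ℚ
1/d*d≡1 (suc d) = trans (cong₂ ℚ._*_ (ℚP.↥p/↧p≡p (mkℚ (+ 1) d (Coprimality.1-coprimeTo _)))
                                     (ι-mk (+ suc d)))
                        (ℚP.*-inverseˡ (ιⁿ (+ suc d)))

-- Uniqueness of the classical quotient.

quotient-difference : ∀ t r r′ m n → t ℚ.* ι m ℚ.- r ≡ t ℚ.* ι n ℚ.- r′ →
  t ℚ.* ι (m ℤ.- n) ≡ r ℚ.- r′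
quotient-difference t r r′ m n e = begin
  t ℚ.* ι (m ℤ.- n)                                     ≡⟨ cong (t ℚ.*_) (ι-- m n) ⟩
  t ℚ.* (ι m ℚ.- ι n)                                   ≡⟨ regroup t (ι m) (ι n) r r′ ⟩
  (t ℚ.* ι m ℚ.- r) ℚ.- (t ℚ.* ι n ℚ.- r′) ℚ.+ (r ℚ.- r′) ≡⟨ cong (λ w → w ℚ.- (t ℚ.* ι n ℚ.- r′) ℚ.+ (r ℚ.- r′)) e ⟩
  (t ℚ.* ι n ℚ.- r′) ℚ.- (t ℚ.* ι n ℚ.- r′) ℚ.+ (r ℚ.- r′) ≡⟨ cancel (t ℚ.* ι n ℚ.- r′) (r ℚ.- r′) ⟩
  r ℚ.- r′                                              ∎
  where
  open ≡-Reasoning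
  open ℚSolver
  regroup : ∀ t x y r r′ → t ℚ.* (x ℚ.- y) ≡ (t ℚ.* x ℚ.- r) ℚ.- (t ℚ.* y ℚ.- r′) ℚ.+ (r ℚ.- r′)
  regroup = solve 5 (λ t x y r r′ → t :* (x :- y) := (t :* x :- r) :- (t :* y :- r′) :+ (r :- r′)) refl
  cancel : ∀ z w → z ℚ.- z ℚ.+ w ≡ w
  cancel = solve 2 (λ z w → z :- z :+ w := w) refl

<⇒1≤difference : ∀ {m n} → n ℤ.< m → ℤ.1ℤ ℤ.≤ m ℤ.- n
<⇒1≤difference {m} {n} n<m = subst (ℤ._≤ m ℤ.- n) (cancel ℤ.1ℤ n)
  (ℤP.+-monoˡ-≤ (ℤ.- n) (ℤP.i<j⇒suc[i]≤j n<m))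
  where
  open ℤSolver
  cancel : ∀ x n → x ℤ.+ n ℤ.- n ≡ x
  cancel = solve 2 (λ x n → x :+ n :- n := x) refl

-- One half of uniqueness: if m > n then t ≤ t·(m − n) = r − r′ ≤ r < t.
quotient-≤ : ∀ {t r r′} m n → ℚ.0ℚ ℚ.≤ t → ℚ.0ℚ ℚ.≤ r′ → r ℚ.< t →
  t ℚ.* ι m ℚ.- r ≡ t ℚ.* ι n ℚ.- r′ → m ℤ.≤ n
quotient-≤ {t} {r} {r′} m n t≥0 r′≥0 r<t e with m ℤP.≤? n
... | yes m≤n = m≤n
... | no m≰n = ⊥-elim (ℚP.<-irrefl refl (begin-strict
  t                  ≡⟨ ℚP.*-identityʳ t ⟨
  t ℚ.* ι ℤ.1ℤ       ≤⟨ ℚP.*-monoˡ-≤-nonNeg t (ι-≤ (<⇒1≤difference (ℤP.≰⇒> m≰n))) ⟩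
  t ℚ.* ι (m ℤ.- n)  ≡⟨ quotient-difference t r r′ m n e ⟩
  r ℚ.- r′           ≤⟨ ℚP.+-monoʳ-≤ r (ℚP.neg-antimono-≤ r′≥0) ⟩
  r ℚ.+ ℚ.0ℚ         ≡⟨ ℚP.+-identityʳ r ⟩
  r                  <⟨ r<t ⟩
  t                  ∎))
  where
  open ℚP.≤-Reasoning
  instance _ = ℚ.nonNegative t≥0

division-unique : ∀ {t r r′} m n → ℚ.0ℚ ℚ.≤ r → r ℚ.< t → ℚ.0ℚ ℚ.≤ r′ → r′ ℚ.< t →
  t ℚ.* ι m ℚ.- r ≡ t ℚ.* ι n ℚ.- r′ → m ≡ n
division-unique m n r≥0 r<t r′≥0 r′<t e = ℤP.≤-antisym
  (quotient-≤ m n t≥0 r′≥0 r<t e) (quotient-≤ n m t≥0 r≥0 r′<t (sym e))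
  where t≥0 = ℚP.<⇒≤ (ℚP.≤-<-trans r≥0 r<t)

x^[m+n] : ∀ x m n → x ^ℕ (m ℕ.+ n) ≡ x ^ℕ m ℚ.* x ^ℕ n
x^[m+n] x zero n = sym (ℚP.*-identityˡ _)
x^[m+n] x (suc m) n = trans (cong (x ℚ.*_) (x^[m+n] x m n)) (sym (ℚP.*-assoc x _ _))

^-mono-∣ : ∀ P {m n} → m ℕ.≤ n → P ℕ.^ m ℕD.∣ P ℕ.^ n
^-mono-∣ P {m} m≤n with ℕP.m≤n⇒∃[o]m+o≡n m≤n
... | o , refl = subst (P ℕ.^ m ℕD.∣_) (sym (ℕP.^-distribˡ-+-* P m o)) (ℕD.m∣m*n (P ℕ.^ o))

+-cancelʳ-≤ : ∀ {i j} c → i ℤ.+ c ℤ.≤ j ℤ.+ c → i ℤ.≤ j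
+-cancelʳ-≤ {i} {j} c i+c≤j+c =
  subst₂ ℤ._≤_ (cancel i c) (cancel j c) (ℤP.+-monoˡ-≤ (ℤ.- c) i+c≤j+c)
  where
  open ℤSolver
  cancel : ∀ x c → x ℤ.+ c ℤ.+ ℤ.- c ≡ x
  cancel = solve 2 (λ x c → (x :+ c) :+ (:- c) := x) refl

sum-swap : ∀ a b c d → a ℕ.+ b ≡ c ℕ.+ d → + a ℤ.- + d ≡ + c ℤ.- + b
sum-swap a b c d a+b≡c+d = begin
  + a ℤ.- + d                 ≡⟨ add-sub (+ a) (+ b) (+ d) ⟩
  + (a ℕ.+ b) ℤ.- + b ℤ.- + d ≡⟨ cong (λ w → + w ℤ.- + b ℤ.- + d) a+b≡c+d ⟩
  + (c ℕ.+ d) ℤ.- + b ℤ.- + d ≡⟨ add-sub′ (+ c) (+ b) (+ d) ⟨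
  + c ℤ.- + b                 ∎
  where
  open ≡-Reasoning
  open ℤSolver
  add-sub : ∀ x y z → x ℤ.- z ≡ x ℤ.+ y ℤ.- y ℤ.- z
  add-sub = solve 3 (λ x y z → x :- z := x :+ y :- y :- z) refl
  add-sub′ : ∀ x y z → x ℤ.- y ≡ x ℤ.+ z ℤ.- y ℤ.- z
  add-sub′ = solve 3 (λ x y z → x :- y := x :+ z :- y :- z) refl

shift-to-ℕ : ∀ k M → ℤ.∣ k ∣ ℕ.≤ M → ∃ λ e → k ℤ.+ + M ≡ + e
shift-to-ℕ (+ m) M _ = m ℕ.+ M , refl
shift-to-ℕ -[1+ m ] M m<M with ℕP.m≤n⇒∃[o]m+o≡n m<M
... | o , refl = o , cancel (+ suc m) (+ o)
  where
  open ℤSolver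
  cancel : ∀ a b → ℤ.- a ℤ.+ (a ℤ.+ b) ≡ b
  cancel = solve 2 (λ a b → (:- a) :+ (a :+ b) := b) refl

prime^-coprime-∣ : ∀ {P} e u X → Prime P → ¬ (P ℕD.∣ u) → P ℕ.^ e ℕD.∣ u ℕ.* X → P ℕ.^ e ℕD.∣ X
prime^-coprime-∣ zero u X pr P∤u _ = ℕD.divides X (sym (ℕP.*-identityʳ X))
prime^-coprime-∣ {P} (suc e) u X pr P∤u P^e+1∣uX
  with euclidsLemma u X pr (ℕD.m*n∣⇒m∣ P (P ℕ.^ e) P^e+1∣uX)
... | inj₁ P∣u = ⊥-elim (P∤u P∣u)
... | inj₂ (ℕD.divides X′ refl) =
  subst (ℕD._∣ X′ ℕ.* P) (ℕP.*-comm (P ℕ.^ e) P) (ℕD.*-monoˡ-∣ P P^e∣X′)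
  where
  instance _ = prime⇒nonZero pr
  open ℕSolver
  regroup : ∀ u x p → u ℕ.* (x ℕ.* p) ≡ p ℕ.* (u ℕ.* x)
  regroup = solve 3 (λ u x p → u :* (x :* p) := p :* (u :* x)) refl
  P^e∣X′ : P ℕ.^ e ℕD.∣ X′
  P^e∣X′ = prime^-coprime-∣ e u X′ pr P∤u
    (ℕD.*-cancelˡ-∣ P (subst (P ℕ.* P ℕ.^ e ℕD.∣_) (regroup u X′ P) P^e+1∣uX))

absP-nonzero : ∀ p x → ℚ.numerator x ≢ ℤ.0ℤ → absP p x ≡ pow p (ℤ.- ordℚ p x)
absP-nonzero p (mkℚ (+ zero) d c) x≢0 = ⊥-elim (x≢0 refl)
absP-nonzero p (mkℚ +[1+ n ] d c) x≢0 = refl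
absP-nonzero p (mkℚ -[1+ n ] d c) x≢0 = refl

-- Everything below concerns a fixed p = q + 2; this form of p lets the
-- valuation ordAux of Defs compute.

module PAdic (q : ℕ) where

  p : ℕ
  p = suc (suc q)

  1<p : 1 ℕ.< p
  1<p = ℕ.s≤s (ℕ.s≤s ℕ.z≤n)

  p^≢0 : ∀ n → p ℕ.^ n ≢ 0
  p^≢0 n = ℕ.≢-nonZero⁻¹ _ {{ℕP.m^n≢0 p n}}

  -- The valuation ord_p on ℕ.

  record Split (n : ℕ) : Set where
    constructor split
    field
      exponent unit : ℕ
      factorisation : n ≡ p ℕ.^ exponent ℕ.* unit
      p∤unit : ¬ (p ℕD.∣ unit)
      unit≢0 : unit ≢ 0

  -- The fuel of ordℕ p n, namely n itself, is enough: j < p^j.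
  j<p^j : ∀ j → j ℕ.< p ℕ.^ j
  j<p^j zero = ℕ.s≤s ℕ.z≤n
  j<p^j (suc j) = ℕP.≤-<-trans (j<p^j j) (ℕP.^-monoʳ-< p 1<p (ℕP.n<1+n j))

  -- With enough fuel, ordAux counts the factors p of n = p^j · u, p ∤ u.  Following
  -- ordAux: a zero remainder n % p is impossible when j = 0 (as p ∤ u), a nonzero
  -- one when j > 0 (as p ∣ n).
  ordAux-split : ∀ fuel j u n → n ≡ p ℕ.^ j ℕ.* u → ¬ (p ℕD.∣ u) → u ≢ 0 → j ℕ.< fuel →
    ordAux fuel p n ≡ j
  ordAux-split (suc fuel) j u zero n≡ p∤u u≢0 _ =
    ⊥-elim ([ p^≢0 j , u≢0 ]′ (ℕP.m*n≡0⇒m≡0∨n≡0 (p ℕ.^ j) (sym n≡)))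
  ordAux-split (suc fuel) j u (suc m) n≡ p∤u u≢0 j<fuel with suc m ℕ.% p in rem
  ordAux-split (suc fuel) zero u (suc m) n≡ p∤u u≢0 _ | zero =
    ⊥-elim (p∤u (subst (p ℕD.∣_) (trans n≡ (ℕP.*-identityˡ u)) (ℕD.m%n≡0⇒n∣m (suc m) p rem)))
  ordAux-split (suc fuel) zero u (suc m) n≡ p∤u u≢0 _ | suc _ = refl
  ordAux-split (suc fuel) (suc j) u (suc m) n≡ p∤u u≢0 j<fuel | zero =
    cong suc (ordAux-split fuel j u (suc m ℕ./ p) m/p≡ p∤u u≢0 (ℕP.≤-pred j<fuel))
    where
    m/p≡ : suc m ℕ./ p ≡ p ℕ.^ j ℕ.* u
    m/p≡ = trans (cong (ℕ._/ p) (trans n≡ (p^j·u-comm j u))) (m*n/n≡m (p ℕ.^ j ℕ.* u) p)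
      where
      p^j·u-comm : ∀ j u → p ℕ.^ suc j ℕ.* u ≡ p ℕ.^ j ℕ.* u ℕ.* p
      p^j·u-comm j u = trans (ℕP.*-assoc p (p ℕ.^ j) u) (ℕP.*-comm p (p ℕ.^ j ℕ.* u))
  ordAux-split (suc fuel) (suc j) u (suc m) n≡ p∤u u≢0 j<fuel | suc _
    with trans (sym rem) (ℕD.n∣m⇒m%n≡0 (suc m) p (subst (p ℕD.∣_) (sym n≡)
           (ℕD.∣m⇒∣m*n u (ℕD.m∣m*n (p ℕ.^ j)))))
  ... | ()

  ord-split : ∀ {n} (s : Split n) → ordℕ p n ≡ Split.exponent s
  ord-split {n} (split j u n≡ p∤u u≢0) = ordAux-split n j u n n≡ p∤u u≢0
    (subst (j ℕ.<_) (sym n≡) (ℕP.<-≤-trans (j<p^j j) (ℕP.m≤m*n (p ℕ.^ j) u {{ℕ.≢-nonZero u≢0}})))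

  split-bounded : ∀ fuel n → n ℕ.≤ fuel → n ≢ 0 → Split n
  split-bounded zero zero _ n≢0 = ⊥-elim (n≢0 refl)
  split-bounded (suc fuel) n n≤ n≢0 with p ℕD.∣? n
  ... | no p∤n = split 0 n (sym (ℕP.*-identityˡ n)) p∤n n≢0
  ... | yes (ℕD.divides m n≡m*p) with split-bounded fuel m m≤fuel m≢0
    where
    m≢0 : m ≢ 0
    m≢0 refl = n≢0 n≡m*p
    m≤fuel : m ℕ.≤ fuel
    m≤fuel = ℕP.≤-pred (ℕP.≤-trans (subst (m ℕ.<_) (sym n≡m*p)
               (ℕP.m<m*n m p {{ℕ.≢-nonZero m≢0}} 1<p)) n≤)
  ... | split j u m≡ p∤u u≢0 = split (suc j) u n≡ p∤u u≢0
    where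
    n≡ : n ≡ p ℕ.^ suc j ℕ.* u
    n≡ = trans n≡m*p (trans (cong (ℕ._* p) m≡)
           (trans (ℕP.*-comm (p ℕ.^ j ℕ.* u) p) (sym (ℕP.*-assoc p (p ℕ.^ j) u))))

  split-of : ∀ n → n ≢ 0 → Split n
  split-of n = split-bounded n n ℕP.≤-refl

  p^ord∣ : ∀ n → n ≢ 0 → p ℕ.^ ordℕ p n ℕD.∣ n
  p^ord∣ n n≢0 with split-of n n≢0
  ... | s@(split j u n≡ _ _) rewrite ord-split s = ℕD.divides u (trans n≡ (ℕP.*-comm _ u))

  ord-p^ : ∀ N → ordℕ p (p ℕ.^ N) ≡ N
  ord-p^ N = ord-split (split N 1 (sym (ℕP.*-identityʳ (p ℕ.^ N))) p∤1 (λ ()))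
    where
    p∤1 : ¬ (p ℕD.∣ 1)
    p∤1 p∣1 with ℕD.∣1⇒≡1 p∣1
    ... | ()

  ord-* : Prime p → ∀ m n → m ≢ 0 → n ≢ 0 → ordℕ p (m ℕ.* n) ≡ ordℕ p m ℕ.+ ordℕ p n
  ord-* pr m n m≢0 n≢0 with split-of m m≢0 | split-of n n≢0
  ... | s@(split j u m≡ p∤u u≢0) | s′@(split j′ u′ n≡ p∤u′ u′≢0)
    rewrite ord-split s | ord-split s′ =
    ord-split (split (j ℕ.+ j′) (u ℕ.* u′) mn≡ p∤uu′ (λ uu′≡0 → [ u≢0 , u′≢0 ]′ (ℕP.m*n≡0⇒m≡0∨n≡0 u uu′≡0)))
    where
    p∤uu′ : ¬ (p ℕD.∣ u ℕ.* u′)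
    p∤uu′ p∣uu′ = [ p∤u , p∤u′ ]′ (euclidsLemma u u′ pr p∣uu′)
    mn≡ : m ℕ.* n ≡ p ℕ.^ (j ℕ.+ j′) ℕ.* (u ℕ.* u′)
    mn≡ = begin
      m ℕ.* n                                     ≡⟨ cong₂ ℕ._*_ m≡ n≡ ⟩
      p ℕ.^ j ℕ.* u ℕ.* (p ℕ.^ j′ ℕ.* u′)         ≡⟨ interchange (p ℕ.^ j) u (p ℕ.^ j′) u′ ⟩
      p ℕ.^ j ℕ.* p ℕ.^ j′ ℕ.* (u ℕ.* u′)         ≡⟨ cong (ℕ._* (u ℕ.* u′)) (ℕP.^-distribˡ-+-* p j j′) ⟨
      p ℕ.^ (j ℕ.+ j′) ℕ.* (u ℕ.* u′)             ∎
      where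
      open ≡-Reasoning
      open ℕSolver
      interchange : ∀ a b c d → a ℕ.* b ℕ.* (c ℕ.* d) ≡ a ℕ.* c ℕ.* (b ℕ.* d)
      interchange = solve 4 (λ a b c d → a :* b :* (c :* d) := a :* c :* (b :* d)) refl

  ord-cancel : Prime p → ∀ {a} e X → a ≢ 0 → p ℕ.^ (ordℕ p a ℕ.+ e) ℕD.∣ a ℕ.* X → p ℕ.^ e ℕD.∣ X
  ord-cancel pr {a} e X a≢0 p^[ord+e]∣aX with split-of a a≢0
  ... | s@(split j u refl p∤u _) rewrite ord-split s =
    prime^-coprime-∣ e u X pr p∤u (ℕD.*-cancelˡ-∣ (p ℕ.^ j) {{ℕP.m^n≢0 p j}}
      (subst₂ ℕD._∣_ (ℕP.^-distribˡ-+-* p j e) (ℕP.*-assoc (p ℕ.^ j) u X) p^[ord+e]∣aX))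

  P : ℚ
  P = ι (+ p)

  P^≡ι : ∀ n → P ^ℕ n ≡ ι (+ (p ℕ.^ n))
  P^≡ι zero = refl
  P^≡ι (suc n) = trans (cong (P ℚ.*_) (P^≡ι n))
    (trans (sym (ι-* (+ p) (+ (p ℕ.^ n)))) (cong ι (sym (ℤP.pos-* p (p ℕ.^ n)))))

  P^-positive : ∀ n → ℚ.Positive (P ^ℕ n)
  P^-positive n = ℚ.positive (subst (ℚ.0ℚ ℚ.<_) (sym (P^≡ι n)) (ι-< (ℤ.+<+ (ℕP.m^n>0 p n))))

  pow-shift : ∀ k N e → k ℤ.+ + N ≡ + e → pow p k ℚ.* P ^ℕ N ≡ P ^ℕ e
  pow-shift (+ m) N e k+N≡e with ℤP.+-injective k+N≡e
  ... | refl = sym (x^[m+n] P m N)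
  pow-shift -[1+ m ] N e k+N≡e = begin
    pow p -[1+ m ] ℚ.* P ^ℕ N                      ≡⟨ cong (λ n → pow p -[1+ m ] ℚ.* P ^ℕ n) N≡ ⟩
    pow p -[1+ m ] ℚ.* P ^ℕ (suc m ℕ.+ e)          ≡⟨ cong (pow p -[1+ m ] ℚ.*_) (x^[m+n] P (suc m) e) ⟩
    pow p -[1+ m ] ℚ.* (P ^ℕ suc m ℚ.* P ^ℕ e)     ≡⟨ ℚP.*-assoc (pow p -[1+ m ]) (P ^ℕ suc m) (P ^ℕ e) ⟨
    pow p -[1+ m ] ℚ.* P ^ℕ suc m ℚ.* P ^ℕ e       ≡⟨ cong (λ x → pow p -[1+ m ] ℚ.* x ℚ.* P ^ℕ e) (P^≡ι (suc m)) ⟩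
    pow p -[1+ m ] ℚ.* ι (+ (p ℕ.^ suc m)) ℚ.* P ^ℕ e ≡⟨ cong (ℚ._* P ^ℕ e) (1/d*d≡1 (p ℕ.^ suc m) {{ℕP.m^n≢0 p (suc m)}}) ⟩
    ℚ.1ℚ ℚ.* P ^ℕ e                                ≡⟨ ℚP.*-identityˡ _ ⟩
    P ^ℕ e                                         ∎
    where
    open ≡-Reasoning
    N≡ : N ≡ suc m ℕ.+ e
    N≡ = ℤP.+-injective (trans (regroup -[1+ m ] (+ N))
           (trans (cong (ℤ._+ + suc m) k+N≡e) (cong +_ (ℕP.+-comm e (suc m)))))
      where
      open ℤSolver
      regroup : ∀ k n → n ≡ k ℤ.+ n ℤ.+ ℤ.- k
      regroup = solve 2 (λ k n → n := (k :+ n) :+ (:- k)) refl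

  -- k ↦ p^k reflects the order (shift both exponents into ℕ, compare in ℕ).
  pow-reflects-≤ : ∀ u v → pow p u ℚ.≤ pow p v → u ℤ.≤ v
  pow-reflects-≤ u v pᵘ≤pᵛ
    with shift-to-ℕ u M (ℕP.m≤m+n _ _) | shift-to-ℕ v M (ℕP.m≤n+m _ _)
    where M = ℤ.∣ u ∣ ℕ.+ ℤ.∣ v ∣
  ... | e₁ , u+M≡e₁ | e₂ , v+M≡e₂ =
    +-cancelʳ-≤ (+ M) (subst₂ ℤ._≤_ (sym u+M≡e₁) (sym v+M≡e₂) (ℤ.+≤+ e₁≤e₂))
    where
    M = ℤ.∣ u ∣ ℕ.+ ℤ.∣ v ∣
    p^e₁≤p^e₂ : ι (+ (p ℕ.^ e₁)) ℚ.≤ ι (+ (p ℕ.^ e₂))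
    p^e₁≤p^e₂ = subst₂ ℚ._≤_ (trans (pow-shift u M e₁ u+M≡e₁) (P^≡ι e₁)) (trans (pow-shift v M e₂ v+M≡e₂) (P^≡ι e₂))
      (ℚP.*-monoʳ-≤-nonNeg (P ^ℕ M) {{ℚP.pos⇒nonNeg (P ^ℕ M) {{P^-positive M}}}} pᵘ≤pᵛ)
    e₁≤e₂ : e₁ ℕ.≤ e₂
    e₁≤e₂ = ℕP.≮⇒≥ (λ e₂<e₁ → ℕP.<⇒≱ (ℕP.^-monoʳ-< p 1<p e₂<e₁) (ℤP.drop‿+≤+ (ι-≤⁻ p^e₁≤p^e₂)))

  -- Valuations of rationals.

  ordℚ-scaled : Prime p → ∀ x d n → d ≢ 0 → x ℚ.* ι (+ d) ≡ ι n → n ≢ ℤ.0ℤ →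
    ordℚ p x ≡ ordℤ p n ℤ.- + ordℕ p d
  ordℚ-scaled pr (mkℚ X D c) d n d≢0 x·d≡n n≢0 =
    sum-swap (ordℕ p ℤ.∣ X ∣) (ordℕ p d) (ordℕ p ℤ.∣ n ∣) (ordℕ p (suc D)) ords
    where
    |n|≢0 : ℤ.∣ n ∣ ≢ 0
    |n|≢0 |n|≡0 = n≢0 (ℤP.∣i∣≡0⇒i≡0 |n|≡0)
    |X|·d≡|n|·D : ℤ.∣ X ∣ ℕ.* d ≡ ℤ.∣ n ∣ ℕ.* suc D
    |X|·d≡|n|·D = begin
      ℤ.∣ X ∣ ℕ.* d                   ≡⟨ ℤP.abs-* X (+ d) ⟨
      ℤ.∣ X ℤ.* + d ∣                 ≡⟨ cong ℤ.∣_∣ (ℤP.*-identityʳ (X ℤ.* + d)) ⟨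
      ℤ.∣ X ℤ.* + d ℤ.* + 1 ∣         ≡⟨ cong ℤ.∣_∣ (cross-multiply X D c d n x·d≡n) ⟩
      ℤ.∣ n ℤ.* + (suc D ℕ.* 1) ∣     ≡⟨ ℤP.abs-* n _ ⟩
      ℤ.∣ n ∣ ℕ.* (suc D ℕ.* 1)       ≡⟨ cong (ℤ.∣ n ∣ ℕ.*_) (ℕP.*-identityʳ (suc D)) ⟩
      ℤ.∣ n ∣ ℕ.* suc D               ∎
      where open ≡-Reasoning
    |X|≢0 : ℤ.∣ X ∣ ≢ 0
    |X|≢0 |X|≡0 = |n|≢0 (ℕP.m*n≡0⇒m≡0 ℤ.∣ n ∣ (suc D) (trans (sym |X|·d≡|n|·D) (cong (ℕ._* d) |X|≡0)))
    ords : ordℕ p ℤ.∣ X ∣ ℕ.+ ordℕ p d ≡ ordℕ p ℤ.∣ n ∣ ℕ.+ ordℕ p (suc D)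
    ords = trans (sym (ord-* pr ℤ.∣ X ∣ d |X|≢0 d≢0))
             (trans (cong (ordℕ p) |X|·d≡|n|·D) (ord-* pr ℤ.∣ n ∣ (suc D) |n|≢0 (λ ())))

  absP-scaled : Prime p → ∀ {x X} N → x ℚ.* P ^ℕ N ≡ ι X → X ≢ ℤ.0ℤ →
    absP p x ≡ pow p (ℤ.- (ordℤ p X ℤ.- + N))
  absP-scaled pr {x} {X} N x·p^N≡X X≢0 = begin
    absP p x                                       ≡⟨ absP-nonzero p x (numerator≢0 x _ X x·p^N≡X X≢0) ⟩
    pow p (ℤ.- ordℚ p x)                           ≡⟨ cong (λ o → pow p (ℤ.- o)) ord-x ⟩
    pow p (ℤ.- (ordℤ p X ℤ.- + N))                 ∎
    where
    open ≡-Reasoning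
    ord-x : ordℚ p x ≡ ordℤ p X ℤ.- + N
    ord-x = trans (ordℚ-scaled pr x (p ℕ.^ N) X (p^≢0 N) (trans (cong (x ℚ.*_) (sym (P^≡ι N))) x·p^N≡X) X≢0)
                  (cong (λ n → ordℤ p X ℤ.- + n) (ord-p^ N))

  absP-≤⇒∣ : Prime p → ∀ {x y X Y} N → x ℚ.* P ^ℕ N ≡ ι X → y ℚ.* P ^ℕ N ≡ ι Y → Y ≢ ℤ.0ℤ →
    absP p x ℚ.≤ absP p y → p ℕ.^ ordℕ p ℤ.∣ Y ∣ ℕD.∣ ℤ.∣ X ∣
  absP-≤⇒∣ pr {x} {y} {X} {Y} N x·p^N≡X y·p^N≡Y Y≢0 |x|≤|y| with X ℤP.≟ ℤ.0ℤ
  ... | yes refl = ℕD._∣0 _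
  ... | no X≢0 = ℕD.∣-trans (^-mono-∣ p ordY≤ordX) (p^ord∣ ℤ.∣ X ∣ (λ |X|≡0 → X≢0 (ℤP.∣i∣≡0⇒i≡0 |X|≡0)))
    where
    exponents : ℤ.- (ordℤ p X ℤ.- + N) ℤ.≤ ℤ.- (ordℤ p Y ℤ.- + N)
    exponents = pow-reflects-≤ _ _
      (subst₂ ℚ._≤_ (absP-scaled pr {x} {X} N x·p^N≡X X≢0) (absP-scaled pr {y} {Y} N y·p^N≡Y Y≢0) |x|≤|y|)
    ordY≤ordX : ordℕ p ℤ.∣ Y ∣ ℕ.≤ ordℕ p ℤ.∣ X ∣
    ordY≤ordX = ℤP.drop‿+≤+ (+-cancelʳ-≤ (ℤ.- + N) (ℤP.neg-cancel-≤ exponents))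

  scale-further : ∀ {x X} n M → x ℚ.* P ^ℕ n ≡ ι X → x ℚ.* P ^ℕ (n ℕ.+ M) ≡ ι (X ℤ.* + (p ℕ.^ M))
  scale-further {x} {X} n M x·p^n≡X = begin
    x ℚ.* P ^ℕ (n ℕ.+ M)           ≡⟨ cong (x ℚ.*_) (x^[m+n] P n M) ⟩
    x ℚ.* (P ^ℕ n ℚ.* P ^ℕ M)      ≡⟨ ℚP.*-assoc x (P ^ℕ n) (P ^ℕ M) ⟨
    x ℚ.* P ^ℕ n ℚ.* P ^ℕ M        ≡⟨ cong₂ ℚ._*_ x·p^n≡X (P^≡ι M) ⟩
    ι X ℚ.* ι (+ (p ℕ.^ M))        ≡⟨ ι-* X _ ⟨
    ι (X ℤ.* + (p ℕ.^ M))          ∎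
    where open ≡-Reasoning

  record CommonScale (k : ℤ) (x y : ℚ) : Set where
    field
      N e : ℕ
      X Y : ℤ
      exponent : k ℤ.+ + N ≡ + e
      x-scaled : x ℚ.* P ^ℕ N ≡ ι X
      y-scaled : y ℚ.* P ^ℕ N ≡ ι Y

  common-scale : ∀ k {x y} → InZ[1/p] p x → InZ[1/p] p y → CommonScale k x y
  common-scale k {x} {y} (n₁ , x-integral) (n₂ , y-integral) = record
    { N = N
    ; e = proj₁ (shift-to-ℕ k N |k|≤N)
    ; X = X₁ ℤ.* + (p ℕ.^ (n₂ ℕ.+ ℤ.∣ k ∣))
    ; Y = Y₂ ℤ.* + (p ℕ.^ (n₁ ℕ.+ ℤ.∣ k ∣))
    ; exponent = proj₂ (shift-to-ℕ k N |k|≤N)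
    ; x-scaled = scale-further {x} {X₁} n₁ _ (denominator1⇒ι (x ℚ.* P ^ℕ n₁) x-integral)
    ; y-scaled = subst (λ n → y ℚ.* P ^ℕ n ≡ ι (Y₂ ℤ.* + (p ℕ.^ (n₁ ℕ.+ ℤ.∣ k ∣))))
                   (swap n₂ n₁ ℤ.∣ k ∣)
                   (scale-further {y} {Y₂} n₂ _ (denominator1⇒ι (y ℚ.* P ^ℕ n₂) y-integral))
    }
    where
    X₁ = ℚ.numerator (x ℚ.* P ^ℕ n₁)
    Y₂ = ℚ.numerator (y ℚ.* P ^ℕ n₂)
    N = n₁ ℕ.+ (n₂ ℕ.+ ℤ.∣ k ∣)
    |k|≤N : ℤ.∣ k ∣ ℕ.≤ N
    |k|≤N = ℕP.≤-trans (ℕP.m≤n+m ℤ.∣ k ∣ n₂) (ℕP.m≤n+m _ n₁)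
    open import Algebra.Properties.CommutativeSemigroup ℕP.+-commutativeSemigroup
      using () renaming (x∙yz≈y∙xz to swap)

  scale-equation : ∀ {a b x y X Y} N → ι b ≡ ι a ℚ.* x ℚ.- y →
    x ℚ.* P ^ℕ N ≡ ι X → y ℚ.* P ^ℕ N ≡ ι Y → b ℤ.* + (p ℕ.^ N) ≡ a ℤ.* X ℤ.- Y
  scale-equation {a} {b} {x} {y} {X} {Y} N b≡ax-y x·p^N≡X y·p^N≡Y = ι-injective (begin
    ι (b ℤ.* + (p ℕ.^ N))                   ≡⟨ ι-* b _ ⟩
    ι b ℚ.* ι (+ (p ℕ.^ N))                 ≡⟨ cong₂ ℚ._*_ b≡ax-y (sym (P^≡ι N)) ⟩
    (ι a ℚ.* x ℚ.- y) ℚ.* P ^ℕ N            ≡⟨ distrib (ι a) x y (P ^ℕ N) ⟩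
    ι a ℚ.* (x ℚ.* P ^ℕ N) ℚ.- y ℚ.* P ^ℕ N ≡⟨ cong₂ (λ u v → ι a ℚ.* u ℚ.- v) x·p^N≡X y·p^N≡Y ⟩
    ι a ℚ.* ι X ℚ.- ι Y                     ≡⟨ cong (ℚ._- ι Y) (ι-* a X) ⟨
    ι (a ℤ.* X) ℚ.- ι Y                     ≡⟨ ι-- (a ℤ.* X) Y ⟨
    ι (a ℤ.* X ℤ.- Y)                       ∎)
    where
    open ≡-Reasoning
    open ℚSolver
    distrib : ∀ a x y c → (a ℚ.* x ℚ.- y) ℚ.* c ≡ a ℚ.* (x ℚ.* c) ℚ.- y ℚ.* c
    distrib = solve 4 (λ a x y c → (a :* x :- y) :* c := a :* (x :* c) :- y :* c) refl

  ap^k-scaled : ∀ a k N e → k ℤ.+ + N ≡ + e → ι a ℚ.* pow p k ℚ.* P ^ℕ N ≡ ι (a ℤ.* + (p ℕ.^ e))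
  ap^k-scaled a k N e k+N≡e = begin
    ι a ℚ.* pow p k ℚ.* P ^ℕ N       ≡⟨ ℚP.*-assoc (ι a) (pow p k) (P ^ℕ N) ⟩
    ι a ℚ.* (pow p k ℚ.* P ^ℕ N)     ≡⟨ cong (ι a ℚ.*_) (trans (pow-shift k N e k+N≡e) (P^≡ι e)) ⟩
    ι a ℚ.* ι (+ (p ℕ.^ e))          ≡⟨ ι-* a _ ⟨
    ι (a ℤ.* + (p ℕ.^ e))            ∎
    where open ≡-Reasoning

  descale : ∀ {x m} k N e → k ℤ.+ + N ≡ + e → x ℚ.* P ^ℕ N ≡ ι (m ℤ.* + (p ℕ.^ e)) →
    x ≡ ι m ℚ.* pow p k
  descale {x} {m} k N e k+N≡e x·p^N≡m·p^e = *-cancelʳ-pos (P ^ℕ N) {{P^-positive N}} x _ (begin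
    x ℚ.* P ^ℕ N                  ≡⟨ x·p^N≡m·p^e ⟩
    ι (m ℤ.* + (p ℕ.^ e))         ≡⟨ ι-* m _ ⟩
    ι m ℚ.* ι (+ (p ℕ.^ e))       ≡⟨ cong (ι m ℚ.*_) (trans (pow-shift k N e k+N≡e) (P^≡ι e)) ⟨
    ι m ℚ.* (pow p k ℚ.* P ^ℕ N)  ≡⟨ ℚP.*-assoc (ι m) (pow p k) (P ^ℕ N) ⟨
    ι m ℚ.* pow p k ℚ.* P ^ℕ N    ∎)
    where open ≡-Reasoning

  -- The divisibility argument.

  remainder-divisible : Prime p → ∀ {a k r R} N e → a ≢ ℤ.0ℤ → k ℤ.+ + N ≡ + e →
    r ℚ.* P ^ℕ N ≡ ι R → absP p r ℚ.≤ absP p (ι a ℚ.* pow p k) →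
    + (p ℕ.^ (ordℕ p ℤ.∣ a ∣ ℕ.+ e)) ℤD.∣ R
  remainder-divisible pr {a} {k} {r} {R} N e a≢0 k+N≡e r·p^N≡R |r|≤|ap^k| =
    ℤD.∣ᵤ⇒∣ {+ (p ℕ.^ (ordℕ p ℤ.∣ a ∣ ℕ.+ e))} {R}
      (subst (λ o → p ℕ.^ o ℕD.∣ ℤ.∣ R ∣) ord-ap^e
        (absP-≤⇒∣ pr {r} {ι a ℚ.* pow p k} {R} {a ℤ.* + (p ℕ.^ e)} N r·p^N≡R (ap^k-scaled a k N e k+N≡e) ap^e≢0 |r|≤|ap^k|))
    where
    |a|≢0 : ℤ.∣ a ∣ ≢ 0
    |a|≢0 |a|≡0 = a≢0 (ℤP.∣i∣≡0⇒i≡0 |a|≡0)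
    ap^e≢0 : a ℤ.* + (p ℕ.^ e) ≢ ℤ.0ℤ
    ap^e≢0 ap^e≡0 = [ |a|≢0 , p^≢0 e ]′
      (ℕP.m*n≡0⇒m≡0∨n≡0 ℤ.∣ a ∣ (trans (sym (ℤP.abs-* a _)) (cong ℤ.∣_∣ ap^e≡0)))
    ord-ap^e : ordℕ p ℤ.∣ a ℤ.* + (p ℕ.^ e) ∣ ≡ ordℕ p ℤ.∣ a ∣ ℕ.+ e
    ord-ap^e = trans (cong (ordℕ p) (ℤP.abs-* a _))
      (trans (ord-* pr ℤ.∣ a ∣ (p ℕ.^ e) |a|≢0 (p^≢0 e)) (cong (ordℕ p ℤ.∣ a ∣ ℕ.+_) (ord-p^ e)))

  exponent-bound : ∀ {k oa ob} N e → k ℤ.≤ + ob ℤ.- + oa → k ℤ.+ + N ≡ + e → oa ℕ.+ e ℕ.≤ ob ℕ.+ N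
  exponent-bound {k} {oa} {ob} N e k≤ob-oa k+N≡e =
    ℤP.drop‿+≤+ (subst₂ ℤ._≤_ lhs rhs (ℤP.+-monoˡ-≤ (+ N ℤ.+ + oa) k≤ob-oa))
    where
    open ℤSolver
    lhs : k ℤ.+ (+ N ℤ.+ + oa) ≡ + (oa ℕ.+ e)
    lhs = trans (solve 3 (λ k n a → k :+ (n :+ a) := (k :+ n) :+ a) refl k (+ N) (+ oa))
            (trans (cong (ℤ._+ + oa) k+N≡e) (cong +_ (ℕP.+-comm e oa)))
    rhs : + ob ℤ.- + oa ℤ.+ (+ N ℤ.+ + oa) ≡ + (ob ℕ.+ N)
    rhs = solve 3 (λ b a n → b :- a :+ (n :+ a) := b :+ n) refl (+ ob) (+ oa) (+ N)

  quotient-divisible : Prime p → ∀ {a b k Q R} N e → a ≢ ℤ.0ℤ → b ≢ ℤ.0ℤ →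
    k ℤ.≤ ordℤ p b ℤ.- ordℤ p a → k ℤ.+ + N ≡ + e → b ℤ.* + (p ℕ.^ N) ≡ a ℤ.* Q ℤ.- R →
    + (p ℕ.^ (ordℕ p ℤ.∣ a ∣ ℕ.+ e)) ℤD.∣ R → + (p ℕ.^ e) ℤD.∣ Q
  quotient-divisible pr {a} {b} {k} {Q} {R} N e a≢0 b≢0 k≤ k+N≡e bp^N≡aQ-R p^∣R =
    ℤD.∣ᵤ⇒∣ {+ (p ℕ.^ e)} {Q} (ord-cancel pr e ℤ.∣ Q ∣ (λ |a|≡0 → a≢0 (ℤP.∣i∣≡0⇒i≡0 |a|≡0))
      (subst (p ℕ.^ (ordℕ p ℤ.∣ a ∣ ℕ.+ e) ℕD.∣_) (ℤP.abs-* a Q) (ℤD.∣⇒∣ᵤ p^∣aQ)))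
    where
    p^∣bp^N : + (p ℕ.^ (ordℕ p ℤ.∣ a ∣ ℕ.+ e)) ℤD.∣ b ℤ.* + (p ℕ.^ N)
    p^∣bp^N = ℤD.∣ᵤ⇒∣ {+ (p ℕ.^ (ordℕ p ℤ.∣ a ∣ ℕ.+ e))} {b ℤ.* + (p ℕ.^ N)}
      (ℕD.∣-trans (^-mono-∣ p (exponent-bound {k} {ordℕ p ℤ.∣ a ∣} {ordℕ p ℤ.∣ b ∣} N e k≤ k+N≡e))
        (subst₂ ℕD._∣_ (sym (ℕP.^-distribˡ-+-* p (ordℕ p ℤ.∣ b ∣) N)) (sym (ℤP.abs-* b _))
          (ℕD.*-monoˡ-∣ (p ℕ.^ N) (p^ord∣ ℤ.∣ b ∣ (λ |b|≡0 → b≢0 (ℤP.∣i∣≡0⇒i≡0 |b|≡0))))))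
    aQ≡ : a ℤ.* Q ≡ b ℤ.* + (p ℕ.^ N) ℤ.+ R
    aQ≡ = trans (solve 2 (λ x y → x := (x :- y) :+ y) refl (a ℤ.* Q) R) (cong (ℤ._+ R) (sym bp^N≡aQ-R))
      where open ℤSolver
    p^∣aQ : + (p ℕ.^ (ordℕ p ℤ.∣ a ∣ ℕ.+ e)) ℤD.∣ a ℤ.* Q
    p^∣aQ = subst (_ ℤD.∣_) (sym aQ≡) (ℤD.∣m∣n⇒∣m+n p^∣bp^N p^∣R)

corollary4p2 : (p : ℕ) → Prime p → (a b k : ℤ) →
  ℤ.0ℤ ℤ.< a → b ≢ ℤ.0ℤ → k ℤ.≤ ordℤ p b ℤ.- ordℤ p a →
  (qp r : ℚ) → InZ[1/p] p qp → InZ[1/p] p r →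
  ι b ≡ ι a ℚ.* qp ℚ.- r → ℚ.0ℚ ℚ.≤ r → r ℚ.< ι a ℚ.* pow p k →
  absP p r ℚ.≤ absP p (ι a ℚ.* pow p k) →
  (q∞ : ℤ) (r′ : ℚ) →
  ι b ≡ ι a ℚ.* pow p k ℚ.* ι q∞ ℚ.- r′ → ℚ.0ℚ ℚ.≤ r′ → r′ ℚ.< ι a ℚ.* pow p k →
  qp ≡ ι q∞ ℚ.* pow p k
corollary4p2 zero pr = ⊥-elim (¬prime[0] pr)
corollary4p2 (suc zero) pr = ⊥-elim (¬prime[1] pr)
corollary4p2 (suc (suc q)) pr a b k 0<a b≢0 k≤ qp r qp∈ r∈ b≡aqp-r 0≤r r<ap^k |r|≤|ap^k|
             q∞ r′ b≡ap^kq∞-r′ 0≤r′ r′<ap^k = begin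
  qp                ≡⟨ qp≡m·p^k ⟩
  ι m ℚ.* pow p k   ≡⟨ cong (λ n → ι n ℚ.* pow p k) m≡q∞ ⟩
  ι q∞ ℚ.* pow p k  ∎
  where
  open ≡-Reasoning
  open PAdic q
  open CommonScale (common-scale k {qp} {r} qp∈ r∈) renaming (X to Q; Y to R)
  a≢0 : a ≢ ℤ.0ℤ
  a≢0 = ≢-sym (ℤP.<⇒≢ 0<a)
  b·p^N≡aQ-R : b ℤ.* + (p ℕ.^ N) ≡ a ℤ.* Q ℤ.- R
  b·p^N≡aQ-R = scale-equation {a} {b} {qp} {r} {Q} {R} N b≡aqp-r x-scaled y-scaled
  p^[ord-a+e]∣R : + (p ℕ.^ (ordℕ p ℤ.∣ a ∣ ℕ.+ e)) ℤD.∣ R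
  p^[ord-a+e]∣R = remainder-divisible pr {k = k} {r = r} N e a≢0 exponent y-scaled |r|≤|ap^k|
  p^e∣Q : + (p ℕ.^ e) ℤD.∣ Q
  p^e∣Q = quotient-divisible pr N e a≢0 b≢0 k≤ exponent b·p^N≡aQ-R p^[ord-a+e]∣R
  m : ℤ
  m = ℤD._∣_.quotient p^e∣Q
  qp≡m·p^k : qp ≡ ι m ℚ.* pow p k
  qp≡m·p^k = descale {m = m} k N e exponent (trans x-scaled (cong ι (ℤD._∣_.equality p^e∣Q)))
  classical-division : ι a ℚ.* pow p k ℚ.* ι m ℚ.- r ≡ ι a ℚ.* pow p k ℚ.* ι q∞ ℚ.- r′
  classical-division = begin
    ι a ℚ.* pow p k ℚ.* ι m ℚ.- r    ≡⟨ cong (ℚ._- r) (ℚP.*-assoc (ι a) (pow p k) (ι m)) ⟩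
    ι a ℚ.* (pow p k ℚ.* ι m) ℚ.- r  ≡⟨ cong (λ x → ι a ℚ.* x ℚ.- r) (trans (ℚP.*-comm (pow p k) (ι m)) (sym qp≡m·p^k)) ⟩
    ι a ℚ.* qp ℚ.- r                 ≡⟨ b≡aqp-r ⟨
    ι b                              ≡⟨ b≡ap^kq∞-r′ ⟩
    ι a ℚ.* pow p k ℚ.* ι q∞ ℚ.- r′  ∎
  m≡q∞ : m ≡ q∞
  m≡q∞ = division-unique m q∞ 0≤r r<ap^k 0≤r′ r′<ap^k classical-division
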